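{- Let $k\ge 5$ and let $T_1,\dots,T_k$ be trees on a common vertex set $V$ with $|V|=n$, having no common leaves (no vertex is a leaf in two different trees). Let $w\in V$ be an arbitrary vertex. If $n\ge 4k-2$, then there is a rainbow matching in the first $k-1$ trees avoiding $w$: that is, there are pairwise vertex-disjoint edges $e_1,\dots,e_{k-1}$, none incident to $w$, with $e_i$ an edge of $T_i$ for each $i$.
   Context: Each $T_i$ is a tree spanning all of $V$. A rainbow matching in an edge-colored graph is a set of pairwise vertex-disjoint edges no two of which have the same color; here the color of an edge is the tree it belongs to. -}

module Defs where

open import Level using (0ℓ)
open import Data.Nat using (ℕ; suc; _≤_; _+_)
open import Data.Fin using (Fin)
open import Data.List using (List; []; _∷_; length)
open import Data.List.Relation.Unary.Unique.Propositional using (Unique)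
open import Data.Product using (Σ; ∃; _×_; _,_)
open import Data.Sum using (_⊎_)
open import Relation.Binary.PropositionalEquality using (_≡_; _≢_)
open import Relation.Nullary using (¬_)

record Graph (n : ℕ) : Set₁ where
  field
    Adj       : Fin n → Fin n → Set
    symmetric : ∀ {u v} → Adj u v → Adj v u
    irreflex  : ∀ {u} → ¬ Adj u u
open Graph public

data Walk {n : ℕ} (G : Graph n) : Fin n → Fin n → Set where
  here : ∀ {u} → Walk G u u
  step : ∀ {u w v} → Adj G u w → Walk G w v → Walk G u v

Connected : ∀ {n} → Graph n → Set
Connected G = ∀ u v → Walk G u v

data PathList {n : ℕ} (G : Graph n) : List (Fin n) → Fin n → Fin n → Set where
  single : ∀ {u} → PathList G (u ∷ []) u u
  cons   : ∀ {u w v xs} → Adj G u w → PathList G (w ∷ xs) w v →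
           PathList G (u ∷ w ∷ xs) u v

HasCycle : ∀ {n} → Graph n → Set
HasCycle {n} G = Σ (List (Fin n)) λ xs → Σ (Fin n) λ u → Σ (Fin n) λ v →
  PathList G xs u v × Unique xs × 3 ≤ length xs × Adj G v u

Acyclic : ∀ {n} → Graph n → Set
Acyclic G = ¬ HasCycle G

IsTree : ∀ {n} → Graph n → Set
IsTree G = Connected G × Acyclic G

IsLeaf : ∀ {n} → Graph n → Fin n → Set
IsLeaf {n} G v = Σ (Fin n) λ u → Adj G v u × (∀ u' → Adj G v u' → u' ≡ u)

Edge : ∀ {n} → Graph n → Set
Edge {n} G = Σ (Fin n) λ a → Σ (Fin n) λ b → Adj G a b

endA : ∀ {n} {G : Graph n} → Edge G → Fin n
endA (a , _ , _) = a

endB : ∀ {n} {G : Graph n} → Edge G → Fin n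
endB (_ , b , _) = b

Incident : ∀ {n} (G : Graph n) → Edge G → Fin n → Set
Incident G e x = (endA {G = G} e ≡ x) ⊎ (endB {G = G} e ≡ x)

Disjoint : ∀ {n} (G H : Graph n) → Edge G → Edge H → Set
Disjoint G H e f = (a ≢ c) × (a ≢ d) × (b ≢ c) × (b ≢ d)
  where
  a = endA {G = G} e
  b = endB {G = G} e
  c = endA {G = H} f
  d = endB {G = H} f

-- Root every tree at w, so that each edge joins a vertex to its parent.  The matching is
-- built one colour at a time, the colour i added last being one whose tree has fewest
-- leaves.  If no edge of T i avoids w and the 2a endpoints of a matching of the other a
-- colours, these 2a + 1 vertices cover T i; every other vertex is then a leaf of T i or
-- the parent of a cover vertex, so n ≤ 4a + 1 + ℓ i.  As the k leaf sets are nonempty and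
-- pairwise disjoint, (a + 1) ℓ i + (k − a − 1) ≤ n, which contradicts n ≥ 4k − 2 as soon
-- as k ≥ 3.

module Submission where

open import Defs
open import Data.Nat using (ℕ; _≤_; _∸_; _+_; _*_; _<_)
open import Data.Fin using (Fin; toℕ)
open import Data.Product using (Σ; _×_)
open import Relation.Binary.PropositionalEquality using (_≢_)
open import Relation.Nullary using (¬_)

open import Data.Nat using (zero; suc; z≤n; s≤s)
open import Data.Nat.Properties
  using (≤-trans; ≤-reflexive; ≤-refl; ≤-pred; n≤1+n; <-irrefl; ≤-<-trans; _<?_; m≤n+m∸n; +-suc; +-assoc; +-comm;
         +-mono-≤; +-monoˡ-≤; +-monoʳ-≤; +-cancelˡ-≤; +-cancelʳ-≤; *-monoʳ-≤; *-identityʳ; module ≤-Reasoning)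
open import Data.Nat.Tactic.RingSolver using (solve-∀)
open import Data.Fin using (zero; suc; _≟_; fromℕ)
open import Data.Fin.Properties using (any?; all?; ¬∀⟶∃¬; toℕ-fromℕ)
open import Data.List
  using (List; []; _∷_; [_]; length; _++_; filter; allFin; map; concat; concatMap; reverse)
open import Data.List.Properties
  using (length-++; length-map; length-tabulate; length-reverse; filter-notAll; map-++; concat-++;
         reverse-++; unfold-reverse; ++-assoc)
open import Data.List.Extrema.Nat using (argmin; argmin-sel; f[argmin]≤f[⊤]; f[argmin]≤f[xs])
open import Data.List.Membership.Propositional using (_∈_; _∉_)
open import Data.List.Membership.Propositional.Properties
  using (∈-filter⁺; ∈-filter⁻; ∈-++⁺ˡ; ∈-++⁺ʳ; ∈-allFin; ∈-map⁺; ∈-length; ∈-∃++)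
import Data.List.Membership.DecPropositional as DecMembership
open import Data.List.Relation.Unary.All as All using (All; []; _∷_)
import Data.List.Relation.Unary.All.Properties as All
open import Data.List.Relation.Unary.Any as Any using (Any; here; there)
import Data.List.Relation.Unary.Any.Properties as Any
open import Data.List.Relation.Unary.AllPairs as AllPairs using ([]; _∷_)
import Data.List.Relation.Unary.AllPairs.Properties as AllPairs
import Data.List.Relation.Unary.First as First
open import Data.List.Relation.Unary.First.Properties using (toView)
open import Data.List.Relation.Unary.Unique.Propositional using (Unique)
open import Data.List.Relation.Unary.Unique.Propositional.Properties using (allFin⁺; filter⁺; concat⁺; ++⁺)
open import Data.List.Relation.Binary.Permutation.Propositional using (↭-sym; ↭⇒↭ₛ)
open import Data.List.Relation.Binary.Permutation.Propositional.Properties using (↭-reverse)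
open import Data.List.Relation.Binary.Permutation.Setoid.Properties using (Unique-resp-↭)
open import Data.Product using (∃; _,_; proj₁; proj₂)
open import Data.Sum as Sum using (_⊎_; inj₁; inj₂; [_,_]′; swap)
open import Data.Empty using (⊥; ⊥-elim)
open import Relation.Nullary using (Dec; yes; no; ¬?)
open import Relation.Nullary.Decidable using (map′; toSum; _×-dec_; _⊎-dec_; _→-dec_)
open import Function using (id)
open import Relation.Binary.PropositionalEquality
  using (_≡_; refl; sym; trans; cong; subst; setoid)

private variable A B : Set

length-concatMap-≥ : ∀ {m} (f : A → List B) {I} → All (λ i → m ≤ length (f i)) I →
                     length I * m ≤ length (concatMap f I)
length-concatMap-≥ f [] = z≤n
length-concatMap-≥ f {i ∷ I} (m≤fi ∷ m≤fI) =
  ≤-trans (+-mono-≤ m≤fi (length-concatMap-≥ f m≤fI)) (≤-reflexive (sym (length-++ (f i))))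

concatMap-++ : ∀ (f : A → List B) xs {ys} → concatMap f (xs ++ ys) ≡ concatMap f xs ++ concatMap f ys
concatMap-++ f xs {ys} = trans (cong concat (map-++ f xs ys)) (sym (concat-++ (map f xs) (map f ys)))

Unique-++⁻ˡ : ∀ (xs : List A) {ys} → Unique (xs ++ ys) → Unique xs
Unique-++⁻ˡ []       _          = []
Unique-++⁻ˡ (x ∷ xs) (x∉ ∷ uxs) = All.++⁻ˡ xs x∉ ∷ Unique-++⁻ˡ xs uxs

Unique-reverse : ∀ {xs : List A} → Unique xs → Unique (reverse xs)
Unique-reverse {A} {xs} = Unique-resp-↭ (setoid A) (↭⇒↭ₛ (↭-sym (↭-reverse xs)))

module _ {m : ℕ} where
  open DecMembership (_≟_ {m}) using (_∈?_)

  Unique-⊆⇒length≤ : ∀ {xs ys : List (Fin m)} → Unique xs → (∀ {x} → x ∈ xs → x ∈ ys) →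
                     length xs ≤ length ys
  Unique-⊆⇒length≤ {[]} _ _ = z≤n
  Unique-⊆⇒length≤ {x ∷ xs} {ys} (x∉xs ∷ uxs) xs⊆ys =
    ≤-trans (s≤s (Unique-⊆⇒length≤ uxs xs⊆ys-x)) (filter-notAll (λ y → ¬? (x ≟ y)) ys x∈ys)
    where
    x∈ys = Any.map (λ x≡y x≢y → x≢y x≡y) (xs⊆ys (here refl))
    xs⊆ys-x : ∀ {z} → z ∈ xs → z ∈ filter (λ y → ¬? (x ≟ y)) ys
    xs⊆ys-x z∈xs = ∈-filter⁺ _ (xs⊆ys (there z∈xs)) (All.lookup x∉xs z∈xs)

  Unique-⊆-++⇒length≤ : ∀ {xs ys zs : List (Fin m)} → Unique xs →
                        (∀ {x} → x ∈ xs → x ∈ ys ⊎ x ∈ zs) → length xs ≤ length ys + length zs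
  Unique-⊆-++⇒length≤ {ys = ys} uxs cover =
    ≤-trans (Unique-⊆⇒length≤ uxs (λ x∈xs → [ ∈-++⁺ˡ , ∈-++⁺ʳ ys ]′ (cover x∈xs)))
            (≤-reflexive (length-++ ys))

  length-allFin : length (allFin m) ≡ m
  length-allFin = length-tabulate id

  Unique⇒length≤ : ∀ {xs : List (Fin m)} → Unique xs → length xs ≤ m
  Unique⇒length≤ uxs = ≤-trans (Unique-⊆⇒length≤ uxs (λ {x} _ → ∈-allFin x)) (≤-reflexive length-allFin)

  firstCommon : ∀ {xs : List (Fin m)} ys → Any (_∈ ys) xs → First.FirstView (_∉ ys) (_∈ ys) xs
  firstCommon ys common with First.first (λ x → swap (toSum (x ∈? ys))) _
  ... | inj₁ fst  = toView fst
  ... | inj₂ none = ⊥-elim (All.All¬⇒¬Any none common)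

module SimplePaths {n : ℕ} (G : Graph n) where
  open DecMembership (_≟_ {n}) using (_∈?_)

  SimplePath : Fin n → Fin n → Set
  SimplePath u v = Σ (List (Fin n)) λ xs → PathList G xs u v × Unique xs

  PathList-head : ∀ {a xs u v} → PathList G (a ∷ xs) u v → a ≡ u
  PathList-head single     = refl
  PathList-head (cons _ _) = refl

  PathList-last∈ : ∀ {xs u v} → PathList G xs u v → v ∈ xs
  PathList-last∈ single     = here refl
  PathList-last∈ (cons _ p) = there (PathList-last∈ p)

  _◅_ : ∀ {u w v xs} → Adj G u w → PathList G xs w v → PathList G (u ∷ xs) u v
  e ◅ single   = cons e single
  e ◅ cons f p = cons e (cons f p)

  _▻_ : ∀ {xs u v w} → PathList G xs u v → Adj G v w → PathList G (xs ++ [ w ]) u w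
  single   ▻ e = cons e single
  cons f p ▻ e = cons f (p ▻ e)

  PathList-reverse : ∀ {xs u v} → PathList G xs u v → PathList G (reverse xs) v u
  PathList-reverse single = single
  PathList-reverse {u ∷ xs} (cons e p) =
    subst (λ ys → PathList G ys _ u) (sym (unfold-reverse u xs)) (PathList-reverse p ▻ symmetric G e)

  PathList-prefix : ∀ xs {z ys u v} → PathList G (xs ++ z ∷ ys) u v → PathList G (xs ++ [ z ]) u z
  PathList-prefix []           single     = single
  PathList-prefix []           (cons _ _) = single
  PathList-prefix (_ ∷ [])     (cons e p) with refl ← PathList-head p = cons e single
  PathList-prefix (_ ∷ x ∷ xs) (cons e p) = cons e (PathList-prefix (x ∷ xs) p)

  PathList-join : ∀ xs {z ys u v} → PathList G (xs ++ [ z ]) u z → PathList G (z ∷ ys) z v →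
                  PathList G (xs ++ z ∷ ys) u v
  PathList-join []           single          q = q
  PathList-join (_ ∷ [])     (cons e single) q = e ◅ q
  PathList-join (_ ∷ x ∷ xs) (cons e p)      q = cons e (PathList-join (x ∷ xs) p q)

  PathList-suffix : ∀ {xs u v w} → PathList G xs u v → Unique xs → w ∈ xs → SimplePath w v
  PathList-suffix p          uxs       (here refl) with refl ← PathList-head p = _ , p , uxs
  PathList-suffix (cons _ p) (_ ∷ uxs) (there w∈)  = PathList-suffix p uxs w∈

  walk⇒simplePath : ∀ {u v} → Walk G u v → SimplePath u v
  walk⇒simplePath here = _ , single , [] ∷ []
  walk⇒simplePath {u} (step e W) with walk⇒simplePath W
  ... | xs , p , uxs with u ∈? xs
  ...   | yes u∈xs = PathList-suffix p uxs u∈xs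
  ...   | no  u∉xs = u ∷ xs , e ◅ p , All.¬Any⇒All¬ xs u∉xs ∷ uxs

  module _ {x y v : Fin n} (e : Adj G x y) where

    meeting-paths⇒cycle : ∀ xs ys {z xs′ ys′} →
      PathList G (xs ++ z ∷ xs′) x v → Unique (xs ++ z ∷ xs′) →
      PathList G (ys ++ z ∷ ys′) y v → Unique (ys ++ z ∷ ys′) →
      All (_∉ ys ++ z ∷ ys′) xs → 2 ≤ length xs + length ys → HasCycle G
    meeting-paths⇒cycle xs ys {z} {xs′} {ys′} p uxs q uys xs∉ 2≤ =
      xs ++ zys , x , y , cyc , ++⁺ (Unique-++⁻ˡ xs uxs) u-zys disjoint , 3≤ , symmetric G e
      where
      zys = z ∷ reverse ys
      reverse-snoc : reverse (ys ++ [ z ]) ≡ zys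
      reverse-snoc = reverse-++ ys [ z ]
      cyc : PathList G (xs ++ zys) x y
      cyc = PathList-join xs (PathList-prefix xs p)
              (subst (λ l → PathList G l z y) reverse-snoc (PathList-reverse (PathList-prefix ys q)))
      u-zys : Unique zys
      u-zys = subst Unique reverse-snoc
                (Unique-reverse (Unique-++⁻ˡ (ys ++ [ z ]) (subst Unique (sym (++-assoc ys [ z ] ys′)) uys)))
      disjoint : ∀ {a} → ¬ (a ∈ xs × a ∈ zys)
      disjoint (a∈xs , here refl)  = All.lookup xs∉ a∈xs (∈-++⁺ʳ ys (here refl))
      disjoint (a∈xs , there a∈ys) = All.lookup xs∉ a∈xs (∈-++⁺ˡ {xs = ys} (Any.reverse⁻ a∈ys))
      3≤ : 3 ≤ length (xs ++ zys)
      3≤ = subst (3 ≤_) (sym length-cycle) (s≤s 2≤)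
        where
        length-cycle : length (xs ++ zys) ≡ suc (length xs + length ys)
        length-cycle = trans (length-++ xs)
          (trans (cong (λ m → length xs + suc m) (length-reverse ys)) (+-suc _ _))

    -- z is the first vertex of the x-path on the y-path.  If the two paths have at most one
    -- vertex before z, one extends the other by the edge; otherwise they close a cycle with it.
    adjacent-paths : Acyclic G → (p : SimplePath x v) (q : SimplePath y v) →
      (∃ λ t → proj₁ p ≡ x ∷ y ∷ t) ⊎ (∃ λ t → proj₁ q ≡ y ∷ x ∷ t)
    adjacent-paths acyclic (xs , p , uxs) (ys , q , uys)
      with firstCommon ys (Any.map (λ { refl → PathList-last∈ q }) (PathList-last∈ p))
    ... | First._++_∷_ {xs = xs₀} {y = z} xs₀∉ys z∈ys xs′ with ∈-∃++ z∈ys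
    ...   | ys₀ , ys′ , refl = shape xs₀ ys₀ xs₀∉ys p uxs q uys
      where
      shape : ∀ as bs → All (_∉ bs ++ z ∷ ys′) as →
              PathList G (as ++ z ∷ xs′) x v → Unique (as ++ z ∷ xs′) →
              PathList G (bs ++ z ∷ ys′) y v → Unique (bs ++ z ∷ ys′) →
              (∃ λ t → as ++ z ∷ xs′ ≡ x ∷ y ∷ t) ⊎ (∃ λ t → bs ++ z ∷ ys′ ≡ y ∷ x ∷ t)
      shape [] [] _ p _ q _ with refl ← PathList-head p | refl ← PathList-head q = ⊥-elim (irreflex G e)
      shape (_ ∷ []) [] _ p _ q _ with refl ← PathList-head p | refl ← PathList-head q = inj₁ (xs′ , refl)
      shape [] (_ ∷ []) _ p _ q _ with refl ← PathList-head p | refl ← PathList-head q = inj₂ (ys′ , refl)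
      shape as@(_ ∷ _ ∷ _) bs as∉ p uxs q uys =
        ⊥-elim (acyclic (meeting-paths⇒cycle as bs p uxs q uys as∉ (s≤s (s≤s z≤n))))
      shape as@(_ ∷ []) bs@(_ ∷ _) as∉ p uxs q uys =
        ⊥-elim (acyclic (meeting-paths⇒cycle as bs p uxs q uys as∉ (s≤s (s≤s z≤n))))
      shape [] bs@(_ ∷ _ ∷ _) as∉ p uxs q uys =
        ⊥-elim (acyclic (meeting-paths⇒cycle [] bs p uxs q uys as∉ (s≤s (s≤s z≤n))))

VertexCover : ∀ {n} → Graph n → List (Fin n) → Set
VertexCover G S = ∀ {a b} → Adj G a b → a ∈ S ⊎ b ∈ S

EdgeAvoiding : ∀ {n} (G : Graph n) → List (Fin n) → Set
EdgeAvoiding G W = Σ (Edge G) λ f → ∀ {v} → Incident G f v → v ∉ W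

module _ {n : ℕ} (G : Graph n) (adj? : ∀ x y → Dec (Adj G x y)) where
  open DecMembership (_≟_ {n}) using (_∈?_)

  avoidingEdge-or-cover : ∀ W → EdgeAvoiding G W ⊎ VertexCover G W
  avoidingEdge-or-cover W with any? (λ a → any? (λ b → adj? a b ×-dec ¬? (a ∈? W) ×-dec ¬? (b ∈? W)))
  ... | yes (a , b , a~b , a∉W , b∉W) = inj₁ ((a , b , a~b) , λ { (inj₁ refl) → a∉W ; (inj₂ refl) → b∉W })
  ... | no  none                       = inj₂ cover
    where
    cover : VertexCover G W
    cover {a} {b} a~b with a ∈? W | b ∈? W
    ... | yes a∈W | _       = inj₁ a∈W
    ... | no  _   | yes b∈W = inj₂ b∈W
    ... | no  a∉W | no  b∉W = ⊥-elim (none (a , b , a~b , a∉W , b∉W))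

module RootedTree {n : ℕ} (G : Graph n) (tree : IsTree G) (r : Fin n) where
  open SimplePaths G
  open DecMembership (_≟_ {n}) using (_∈?_)

  toRoot : ∀ v → SimplePath v r
  toRoot v with v ≟ r
  ... | yes refl = [ r ] , single , [] ∷ []
  ... | no _     = walk⇒simplePath (proj₁ tree v r)

  toRoot-root : proj₁ (toRoot r) ≡ [ r ]
  toRoot-root with r ≟ r
  ... | yes refl = refl
  ... | no r≢r   = ⊥-elim (r≢r refl)

  -- The value at lists shorter than two is junk: it only arises for the root.
  second : List (Fin n) → Fin n
  second (_ ∷ y ∷ _) = y
  second _           = r

  parent : Fin n → Fin n
  parent v = second (proj₁ (toRoot v))

  parent-adj : ∀ {v} → v ≢ r → Adj G v (parent v)
  parent-adj {v} v≢r = second-adj (proj₁ (proj₂ (toRoot v)))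
    where
    second-adj : ∀ {xs} → PathList G xs v r → Adj G v (second xs)
    second-adj single     = ⊥-elim (v≢r refl)
    second-adj (cons e _) = e

  toRoot-parent : ∀ {v p} → (∃ λ t → proj₁ (toRoot v) ≡ v ∷ p ∷ t) → v ≢ r × parent v ≡ p
  toRoot-parent {v} (_ , eq) = v≢r , cong second eq
    where
    v≢r : v ≢ r
    v≢r refl with () ← trans (sym toRoot-root) eq

  ParentEdge : Fin n → Fin n → Set
  ParentEdge x y = (x ≢ r × parent x ≡ y) ⊎ (y ≢ r × parent y ≡ x)

  edge-parent : ∀ {x y} → Adj G x y → ParentEdge x y
  edge-parent e = Sum.map toRoot-parent toRoot-parent (adjacent-paths e (proj₂ tree) (toRoot _) (toRoot _))

  parentEdge⇒adj : ∀ {x y} → ParentEdge x y → Adj G x y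
  parentEdge⇒adj (inj₁ (x≢r , refl)) = parent-adj x≢r
  parentEdge⇒adj (inj₂ (y≢r , refl)) = symmetric G (parent-adj y≢r)

  adj? : ∀ x y → Dec (Adj G x y)
  adj? x y = map′ parentEdge⇒adj edge-parent
    ((¬? (x ≟ r) ×-dec parent x ≟ y) ⊎-dec (¬? (y ≟ r) ×-dec parent y ≟ x))

  isLeaf? : ∀ v → Dec (IsLeaf G v)
  isLeaf? v = any? λ u → adj? v u ×-dec all? λ u′ → adj? v u′ →-dec u′ ≟ u

  leaves : List (Fin n)
  leaves = filter isLeaf? (allFin n)

  ∈leaves⇒IsLeaf : ∀ {v} → v ∈ leaves → IsLeaf G v
  ∈leaves⇒IsLeaf v∈ = proj₂ (∈-filter⁻ isLeaf? {xs = allFin n} v∈)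

  HasChild : Fin n → Set
  HasChild x = ∃ λ y → y ≢ r × parent y ≡ x

  nonLeaf⇒hasChild : ∀ {x} → x ≢ r → ¬ IsLeaf G x → HasChild x
  nonLeaf⇒hasChild {x} x≢r ¬leaf
    with ¬∀⟶∃¬ n _ (λ u → adj? x u →-dec u ≟ parent x) (λ only → ¬leaf (parent x , parent-adj x≢r , only))
  ... | u , ¬[x~u⇒u≡p] with adj? x u | u ≟ parent x
  ...   | no ¬x~u | _       = ⊥-elim (¬[x~u⇒u≡p] (λ x~u → ⊥-elim (¬x~u x~u)))
  ...   | yes _   | yes u≡p = ⊥-elim (¬[x~u⇒u≡p] (λ _ → u≡p))
  ...   | yes x~u | no u≢p with edge-parent x~u
  ...     | inj₁ (_ , p≡u)  = ⊥-elim (u≢p (sym p≡u))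
  ...     | inj₂ (u≢r , pu≡x) = u , u≢r , pu≡x

  root-hasChild : ∀ {o} → o ≢ r → HasChild r
  root-hasChild {o} o≢r with proj₁ tree r o
  ... | here       = ⊥-elim (o≢r refl)
  ... | step r~y _ with edge-parent r~y
  ...   | inj₁ (r≢r , _)  = ⊥-elim (r≢r refl)
  ...   | inj₂ (y≢r , py≡r) = _ , y≢r , py≡r

  -- Without leaves every vertex has a child, so parent maps the non-root vertices onto all of them.
  leaves-nonempty : ∀ {o} → o ≢ r → 1 ≤ length leaves
  leaves-nonempty {o} o≢r with any? isLeaf?
  ... | yes (v , leaf) = ∈-length (∈-filter⁺ isLeaf? (∈-allFin v) leaf)
  ... | no  noLeaf     = ⊥-elim (<-irrefl refl (≤-<-trans n≤|nonRoots| |nonRoots|<n))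
    where
    nonRoots = filter (λ v → ¬? (v ≟ r)) (allFin n)
    hasChild : ∀ x → HasChild x
    hasChild x with x ≟ r
    ... | yes refl = root-hasChild o≢r
    ... | no  x≢r  = nonLeaf⇒hasChild x≢r (λ leaf → noLeaf (x , leaf))
    covered : ∀ {x} → x ∈ allFin n → x ∈ map parent nonRoots
    covered {x} _ with hasChild x
    ... | y , y≢r , refl = ∈-map⁺ parent (∈-filter⁺ _ (∈-allFin y) y≢r)
    n≤|nonRoots| : n ≤ length nonRoots
    n≤|nonRoots| = ≤-trans (≤-reflexive (sym (length-allFin {n})))
      (≤-trans (Unique-⊆⇒length≤ (allFin⁺ n) covered) (≤-reflexive (length-map parent nonRoots)))
    |nonRoots|<n : length nonRoots < n
    |nonRoots|<n = subst (length nonRoots <_) (length-allFin {n})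
      (filter-notAll _ (allFin n) (Any.map (λ { refl r≢r → r≢r refl }) (∈-allFin r)))

  vertexCover-bound : ∀ U → VertexCover G (r ∷ U) → n ≤ suc (length U) + (length leaves + length U)
  vertexCover-bound U cover = begin
    n                                                    ≡⟨ length-allFin {n} ⟨
    length (allFin n)                                    ≤⟨ Unique-⊆-++⇒length≤ (allFin⁺ n) classify ⟩
    suc (length U) + length (leaves ++ map parent U)     ≡⟨ cong (suc (length U) +_) |leaves++parents| ⟩
    suc (length U) + (length leaves + length U)          ∎
    where
    open ≤-Reasoning
    |leaves++parents| : length (leaves ++ map parent U) ≡ length leaves + length U
    |leaves++parents| = trans (length-++ leaves) (cong (length leaves +_) (length-map parent U))
    parent∈ : ∀ {x} → x ∉ r ∷ U → ¬ IsLeaf G x → x ∈ map parent U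
    parent∈ {x} x∉ ¬leaf with nonLeaf⇒hasChild (λ x≡r → x∉ (here x≡r)) ¬leaf
    ... | y , y≢r , refl with cover (parent-adj y≢r)
    ...   | inj₁ (here y≡r)  = ⊥-elim (y≢r y≡r)
    ...   | inj₁ (there y∈U) = ∈-map⁺ parent y∈U
    ...   | inj₂ p∈          = ⊥-elim (x∉ p∈)
    classify : ∀ {x} → x ∈ allFin n → x ∈ r ∷ U ⊎ x ∈ leaves ++ map parent U
    classify {x} x∈ with x ∈? r ∷ U | isLeaf? x
    ... | yes x∈W | _        = inj₁ x∈W
    ... | no  _   | yes leaf = inj₂ (∈-++⁺ˡ (∈-filter⁺ isLeaf? x∈ leaf))
    ... | no  x∉W | no ¬leaf = inj₂ (∈-++⁺ʳ leaves (parent∈ x∉W ¬leaf))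

counting-contradiction : ∀ {a ℓ c n k} → suc a * ℓ + c ≤ n → k ≤ suc a + c →
                 n ≤ suc (a + a) + (ℓ + (a + a)) → 4 * k ≤ 2 + n → 2 + a ≤ k → 3 ≤ k → ⊥
counting-contradiction {a} {ℓ} {c} {n} {k} leaves≤n k≤ n≤ 4k≤ 2+a≤k 3≤k =
  3≰2 (≤-trans 3≤k (≤-trans k≤ (s≤s a+c≤1)))
  where
  open ≤-Reasoning
  3≰2 : 3 ≤ 2 → ⊥
  3≰2 (s≤s (s≤s ()))
  eq₁ : ∀ a → 4 * (2 + a) ≡ 5 + (3 + 4 * a)
  eq₁ = solve-∀
  eq₂ : ∀ a ℓ → suc (a + a) + (ℓ + (a + a)) ≡ ℓ + (1 + 4 * a)
  eq₂ = solve-∀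
  eq₂′ : ∀ a ℓ → 2 + (ℓ + (1 + 4 * a)) ≡ ℓ + (3 + 4 * a)
  eq₂′ = solve-∀
  eq₃ : ∀ a c → 4 * a + (a + c) ≡ a * 5 + c
  eq₃ = solve-∀
  5≤ℓ : 5 ≤ ℓ
  5≤ℓ = +-cancelʳ-≤ (3 + 4 * a) 5 ℓ (begin
    5 + (3 + 4 * a)                       ≡⟨ eq₁ a ⟨
    4 * (2 + a)                           ≤⟨ *-monoʳ-≤ 4 2+a≤k ⟩
    4 * k                                 ≤⟨ 4k≤ ⟩
    2 + n                                 ≤⟨ +-monoʳ-≤ 2 n≤ ⟩
    2 + (suc (a + a) + (ℓ + (a + a)))     ≡⟨ cong (2 +_) (eq₂ a ℓ) ⟩
    2 + (ℓ + (1 + 4 * a))                 ≡⟨ eq₂′ a ℓ ⟩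
    ℓ + (3 + 4 * a)                       ∎)
  aℓ+c≤ : a * ℓ + c ≤ 1 + 4 * a
  aℓ+c≤ = +-cancelˡ-≤ ℓ _ _ (begin
    ℓ + (a * ℓ + c)                       ≡⟨ +-assoc ℓ (a * ℓ) c ⟨
    suc a * ℓ + c                         ≤⟨ leaves≤n ⟩
    n                                     ≤⟨ n≤ ⟩
    suc (a + a) + (ℓ + (a + a))           ≡⟨ eq₂ a ℓ ⟩
    ℓ + (1 + 4 * a)                       ∎)
  a+c≤1 : a + c ≤ 1
  a+c≤1 = +-cancelˡ-≤ (4 * a) _ _ (begin
    4 * a + (a + c)                       ≡⟨ eq₃ a c ⟩
    a * 5 + c                             ≤⟨ +-monoˡ-≤ c (*-monoʳ-≤ a 5≤ℓ) ⟩
    a * ℓ + c                             ≤⟨ aℓ+c≤ ⟩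
    1 + 4 * a                             ≡⟨ +-comm 1 (4 * a) ⟩
    4 * a + 1                             ∎)

∃≢ : ∀ {n} → 2 ≤ n → (w : Fin n) → ∃ λ o → o ≢ w
∃≢ (s≤s (s≤s _)) zero    = suc zero , λ ()
∃≢ (s≤s (s≤s _)) (suc _) = zero , λ ()

unshared⇒Disjoint : ∀ {n} (G H : Graph n) (e : Edge G) (f : Edge H) →
                    (∀ {v} → Incident G e v → ¬ Incident H f v) → Disjoint G H e f
unshared⇒Disjoint G H e f apart =
  (λ { refl → apart (inj₁ refl) (inj₁ refl) }) , (λ { refl → apart (inj₁ refl) (inj₂ refl) }) ,
  (λ { refl → apart (inj₂ refl) (inj₁ refl) }) , (λ { refl → apart (inj₂ refl) (inj₂ refl) })

module RainbowMatchings {k n : ℕ} (T : Fin k → Graph n) (trees : ∀ i → IsTree (T i))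
  (noCommonLeaf : ∀ i j → i ≢ j → ∀ v → ¬ (IsLeaf (T i) v × IsLeaf (T j) v)) (w : Fin n) where

  module Tree (i : Fin k) = RootedTree (T i) (trees i) w

  ℓ : Fin k → ℕ
  ℓ i = length (Tree.leaves i)

  EdgeChoice : List (Fin k) → Set
  EdgeChoice R = ∀ {i} → i ∈ R → Edge (T i)

  record RainbowMatching (R : List (Fin k)) : Set where
    field
      edge     : EdgeChoice R
      avoids   : ∀ {i} (i∈R : i ∈ R) → ¬ Incident (T i) (edge i∈R) w
      disjoint : ∀ {i j} (i∈R : i ∈ R) (j∈R : j ∈ R) → i ≢ j → Disjoint (T i) (T j) (edge i∈R) (edge j∈R)
  open RainbowMatching

  restrict : ∀ {R S} → (∀ {i} → i ∈ R → i ∈ S) → RainbowMatching S → RainbowMatching R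
  restrict R⊆S M = record
    { edge     = λ i∈R → edge M (R⊆S i∈R)
    ; avoids   = λ i∈R → avoids M (R⊆S i∈R)
    ; disjoint = λ i∈R j∈R → disjoint M (R⊆S i∈R) (R⊆S j∈R)
    }

  endpoints : ∀ R → EdgeChoice R → List (Fin n)
  endpoints []      e = []
  endpoints (i ∷ R) e = endA {G = T i} (e (here refl)) ∷ endB {G = T i} (e (here refl))
                      ∷ endpoints R (λ i∈R → e (there i∈R))

  length-endpoints : ∀ R (e : EdgeChoice R) → length (endpoints R e) ≡ length R + length R
  length-endpoints []      e = refl
  length-endpoints (i ∷ R) e =
    cong suc (trans (cong suc (length-endpoints R (λ j∈R → e (there j∈R)))) (sym (+-suc (length R) (length R))))

  incident⇒∈endpoints : ∀ R (e : EdgeChoice R) {i v} (i∈R : i ∈ R) →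
                        Incident (T i) (e i∈R) v → v ∈ endpoints R e
  incident⇒∈endpoints (i ∷ R) e (here refl)  (inj₁ refl) = here refl
  incident⇒∈endpoints (i ∷ R) e (here refl)  (inj₂ refl) = there (here refl)
  incident⇒∈endpoints (_ ∷ R) e (there i∈R) inc =
    there (there (incident⇒∈endpoints R (λ j∈R → e (there j∈R)) i∈R inc))

  extend : ∀ {R i} (M : RainbowMatching R) → EdgeAvoiding (T i) (w ∷ endpoints R (edge M)) →
           RainbowMatching (i ∷ R)
  extend {R} M (f , f-avoids) = record { edge = edge′ ; avoids = avoids′ ; disjoint = disjoint′ }
    where
    edge′ : EdgeChoice (_ ∷ R)
    edge′ (here refl) = f
    edge′ (there j∈R) = edge M j∈R
    apart : ∀ {j} (j∈R : j ∈ R) {v} → Incident (T _) f v → ¬ Incident (T j) (edge M j∈R) v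
    apart j∈R f∋v g∋v = f-avoids f∋v (there (incident⇒∈endpoints R (edge M) j∈R g∋v))
    avoids′ : ∀ {j} (j∈ : j ∈ _ ∷ R) → ¬ Incident (T j) (edge′ j∈) w
    avoids′ (here refl) f∋w = f-avoids f∋w (here refl)
    avoids′ (there j∈R)     = avoids M j∈R
    disjoint′ : ∀ {j j′} (j∈ : j ∈ _ ∷ R) (j′∈ : j′ ∈ _ ∷ R) → j ≢ j′ →
                Disjoint (T j) (T j′) (edge′ j∈) (edge′ j′∈)
    disjoint′ (here refl) (here refl)  j≢j′ = ⊥-elim (j≢j′ refl)
    disjoint′ (here refl) (there j′∈R) _    = unshared⇒Disjoint (T _) (T _) f (edge M j′∈R) (apart j′∈R)
    disjoint′ (there j∈R) (here refl)  _    =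
      unshared⇒Disjoint (T _) (T _) (edge M j∈R) f (λ g∋v f∋v → apart j∈R f∋v g∋v)
    disjoint′ (there j∈R) (there j′∈R) j≢j′ = disjoint M j∈R j′∈R j≢j′

  leaves-disjoint : ∀ {I} → Unique I → length (concatMap Tree.leaves I) ≤ n
  leaves-disjoint uI =
    Unique⇒length≤ (concat⁺ (All.map⁺ (All.tabulate λ {i} _ → filter⁺ (Tree.isLeaf? i) (allFin⁺ n)))
                            (AllPairs.map⁺ (AllPairs.map noShared uI)))
    where
    noShared : ∀ {i j} → i ≢ j → ∀ {v} → ¬ (v ∈ Tree.leaves i × v ∈ Tree.leaves j)
    noShared {i} {j} i≢j (v∈i , v∈j) =
      noCommonLeaf i j i≢j _ (Tree.∈leaves⇒IsLeaf i v∈i , Tree.∈leaves⇒IsLeaf j v∈j)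

  module _ (3≤k : 3 ≤ k) (4k≤ : 4 * k ≤ 2 + n) where
    open DecMembership (_≟_ {k}) using (_∈?_)

    2≤n : 2 ≤ n
    2≤n = +-cancelˡ-≤ 2 2 n (≤-trans (s≤s (s≤s (s≤s (s≤s z≤n)))) (≤-trans (*-monoʳ-≤ 4 3≤k) 4k≤))

    ℓ≥1 : ∀ i → 1 ≤ ℓ i
    ℓ≥1 i = Tree.leaves-nonempty i (proj₂ (∃≢ 2≤n w))

    minimal-colour-uncovered : ∀ {i R} → Unique (i ∷ R) → 2 + length R ≤ k → All (λ j → ℓ i ≤ ℓ j) R →
                               ∀ U → length U ≡ length R + length R → ¬ VertexCover (T i) (w ∷ U)
    minimal-colour-uncovered {i} {R} uI 2+R≤k minimal U |U| cover =
      counting-contradiction leaves≤n k≤ n≤ 4k≤ 2+R≤k 3≤k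
      where
      I = i ∷ R
      ∉I? : ∀ j → Dec (j ∉ I)
      ∉I? j = ¬? (j ∈? I)
      C = filter ∉I? (allFin k)
      leavesOf = concatMap Tree.leaves
      I#C : ∀ {j} → ¬ (j ∈ I × j ∈ C)
      I#C (j∈I , j∈C) = proj₂ (∈-filter⁻ ∉I? {xs = allFin k} j∈C) j∈I
      leaves≤n : length I * ℓ i + length C ≤ n
      leaves≤n = begin
        length I * ℓ i + length C                          ≡⟨ cong (length I * ℓ i +_) (*-identityʳ (length C)) ⟨
        length I * ℓ i + length C * 1                      ≤⟨ +-mono-≤ (length-concatMap-≥ Tree.leaves (≤-refl ∷ minimal))
                                                                        (length-concatMap-≥ Tree.leaves {C} (All.tabulate λ _ → ℓ≥1 _)) ⟩
        length (leavesOf I) + length (leavesOf C)          ≡⟨ length-++ (leavesOf I) ⟨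
        length (leavesOf I ++ leavesOf C)                  ≡⟨ cong length (concatMap-++ Tree.leaves I) ⟨
        length (leavesOf (I ++ C))                         ≤⟨ leaves-disjoint (++⁺ uI (filter⁺ ∉I? (allFin⁺ k)) I#C) ⟩
        n                                                  ∎
        where open ≤-Reasoning
      k≤ : k ≤ length I + length C
      k≤ = ≤-trans (≤-reflexive (sym (length-allFin {k}))) (Unique-⊆-++⇒length≤ (allFin⁺ k) classify)
        where
        classify : ∀ {j} → j ∈ allFin k → j ∈ I ⊎ j ∈ C
        classify {j} j∈ with j ∈? I
        ... | yes j∈I = inj₁ j∈I
        ... | no  j∉I = inj₂ (∈-filter⁺ ∉I? j∈ j∉I)
      n≤ : n ≤ suc (length R + length R) + (ℓ i + (length R + length R))
      n≤ = subst (λ u → n ≤ suc u + (ℓ i + u)) |U| (Tree.vertexCover-bound i U cover)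

    matching : ∀ m {R} → Unique R → length R ≤ m → m < k → RainbowMatching R
    matching _       {[]}     _  _          _   = record { edge = λ () ; avoids = λ () ; disjoint = λ () }
    matching (suc m) {i ∷ R₀} uR (s≤s |R₀|≤m) m<k =
      extend-or-absurd (avoidingEdge-or-cover (T im) (Tree.adj? im) W)
      where
      R = i ∷ R₀
      im = argmin ℓ i R₀
      im∈R : im ∈ R
      im∈R = [ here , there ]′ (argmin-sel ℓ i R₀)
      minimal : All (λ j → ℓ im ≤ ℓ j) R
      minimal = f[argmin]≤f[⊤] {f = ℓ} i R₀ ∷ f[argmin]≤f[xs] {f = ℓ} i R₀
      ≢im? : ∀ j → Dec (j ≢ im)
      ≢im? j = ¬? (j ≟ im)
      R′ = filter ≢im? R
      uR′ : Unique R′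
      uR′ = filter⁺ ≢im? uR
      im∉R′ : All (im ≢_) R′
      im∉R′ = All.tabulate λ j∈R′ im≡j → proj₂ (∈-filter⁻ ≢im? {xs = R} j∈R′) (sym im≡j)
      minimal′ : All (λ j → ℓ im ≤ ℓ j) R′
      minimal′ = All.tabulate λ j∈R′ → All.lookup minimal (proj₁ (∈-filter⁻ ≢im? {xs = R} j∈R′))
      |R′|≤m : length R′ ≤ m
      |R′|≤m = ≤-trans (≤-pred (filter-notAll ≢im? R (Any.map (λ im≡j j≢im → j≢im (sym im≡j)) im∈R))) |R₀|≤m
      R⊆ : ∀ {j} → j ∈ R → j ∈ im ∷ R′
      R⊆ {j} j∈R = [ here , (λ j≢im → there (∈-filter⁺ ≢im? j∈R j≢im)) ]′ (toSum (j ≟ im))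
      M′ : RainbowMatching R′
      M′ = matching m uR′ |R′|≤m (≤-trans (n≤1+n (suc m)) m<k)
      W = w ∷ endpoints R′ (edge M′)
      extend-or-absurd : EdgeAvoiding (T im) W ⊎ VertexCover (T im) W → RainbowMatching R
      extend-or-absurd (inj₁ f)     = restrict R⊆ (extend M′ f)
      extend-or-absurd (inj₂ cover) =
        ⊥-elim (minimal-colour-uncovered (im∉R′ ∷ uR′) (≤-trans (s≤s (s≤s |R′|≤m)) m<k) minimal′
                                         (endpoints R′ (edge M′)) (length-endpoints R′ (edge M′)) cover)

theorem3 : (k n : ℕ) → 5 ≤ k → (T : Fin k → Graph n) →
    (∀ i → IsTree (T i)) →
    (∀ i j → i ≢ j → ∀ v → ¬ (IsLeaf (T i) v × IsLeaf (T j) v)) →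
    (w : Fin n) → 4 * k ∸ 2 ≤ n →
    Σ ((i : Fin k) → toℕ i < k ∸ 1 → Edge (T i)) λ e →
    (∀ i (hi : toℕ i < k ∸ 1) → ¬ Incident (T i) (e i hi) w) ×
    (∀ i j (hi : toℕ i < k ∸ 1) (hj : toℕ j < k ∸ 1) → i ≢ j →
    Disjoint (T i) (T j) (e i hi) (e j hj))
theorem3 k@(suc k′) n 5≤k T trees noCommonLeaf w 4k∸2≤n =
  (λ i i<k′ → edge M (colour∈ i<k′)) ,
  (λ i i<k′ → avoids M (colour∈ i<k′)) ,
  (λ i j i<k′ j<k′ → disjoint M (colour∈ i<k′) (colour∈ j<k′))
  where
  open RainbowMatchings T trees noCommonLeaf w
  open RainbowMatching
  early? : ∀ i → Dec (toℕ i < k′)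
  early? i = toℕ i <? k′
  colours = filter early? (allFin k)
  colour∈ : ∀ {i} → toℕ i < k′ → i ∈ colours
  colour∈ {i} = ∈-filter⁺ early? (∈-allFin i)
  |colours|<k : length colours < k
  |colours|<k = subst (length colours <_) (length-allFin {k})
    (filter-notAll early? (allFin k)
      (Any.map (λ { refl last<k′ → <-irrefl (toℕ-fromℕ k′) last<k′ }) (∈-allFin (fromℕ k′))))
  M : RainbowMatching colours
  M = matching 3≤k 4k≤2+n (length colours) (filter⁺ early? (allFin⁺ k)) ≤-refl |colours|<k
    where
    3≤k = ≤-trans (s≤s (s≤s (s≤s z≤n))) 5≤k
    4k≤2+n = ≤-trans (m≤n+m∸n (4 * k) 2) (+-monoʳ-≤ 2 4k∸2≤n)
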